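{- Let $n\ge 2$ be even and $1\le\Delta\le\lfloor\log_2 n\rfloor$, and consider the Kn\"odel graph $W_{\Delta,n}$ with partite sets $U=\{u_1,\dots,u_{n/2}\}$ and $V=\{v_1,\dots,v_{n/2}\}$. For any two distinct vertices $u_i,u_j\in U$, we have $|N(u_i)\cap N(u_j)|=2$ if and only if both $id(u_i,u_j)\in\mathscr{M}_\Delta$ and $\frac{n}{2}-id(u_i,u_j)\in\mathscr{M}_\Delta$.
   Context: The Kn\"odel graph $W_{\Delta,n}$ (for even $n\ge2$, $1\le\Delta\le\lfloor\log_2 n\rfloor$) is the bipartite graph with partite sets $U=\{u_1,\dots,u_{n/2}\}$ and $V=\{v_1,\dots,v_{n/2}\}$ in which $u_i$ and $v_j$ are adjacent if and only if $j\equiv i+2^k-1 \pmod{n/2}$ for some $k\in\{0,1,\dots,\Delta-1\}$ (indices taken in $\{1,\dots,n/2\}$). $N(x)$ denotes the open neighborhood of a vertex $x$. For $u_i,u_j\in U$ the index-distance is $id(u_i,u_j)=\min\{|i-j|,\ \frac{n}{2}-|i-j|\}$. The set $\mathscr{M}_\Delta$ is $\{2^a-2^b: 0\le b<a<\Delta\}$ (integers $a,b$). -}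

module Defs where

open import Data.Nat using (ℕ; zero; suc; _+_; _∸_; _^_; _<_; ∣_-_∣; _⊓_)
open import Data.Nat.DivMod using (_%_)
open import Data.Nat.Properties using (_≟_)
open import Data.Fin using (Fin; toℕ)
open import Data.Fin.Properties using (any?)
open import Data.List using (length; filter; allFin)
open import Data.Product using (∃-syntax; _×_)
open import Relation.Binary.PropositionalEquality using (_≡_)
open import Relation.Nullary using (Dec)
open import Relation.Nullary.Decidable using (_×-dec_)

-- Indices are 0-based: u_i, v_j are represented by i, j : Fin m with m = n/2
-- (the paper's index t ∈ {1..m} corresponds to t-1; the adjacency relation
-- j ≡ i + 2^k - 1 (mod m) and the index-distance are invariant under this shift).

-- a mod m, with the harmless convention a mod 0 = a (m ≥ 1 in the theorem).
_mod_ : ℕ → ℕ → ℕ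
a mod zero    = a
a mod (suc k) = a % suc k

Adj : (m Δ : ℕ) → Fin m → Fin m → Set
Adj m Δ i j = ∃[ k ] (toℕ j ≡ (toℕ i + 2 ^ toℕ {Δ} k ∸ 1) mod m)

adj? : (m Δ : ℕ) (i j : Fin m) → Dec (Adj m Δ i j)
adj? m Δ i j = any? λ k → toℕ j ≟ ((toℕ i + 2 ^ toℕ {Δ} k ∸ 1) mod m)

commonNbrs : (m Δ : ℕ) → Fin m → Fin m → ℕ
commonNbrs m Δ i j = length (filter (λ v → adj? m Δ i v ×-dec adj? m Δ j v) (allFin m))

idist : (m : ℕ) → Fin m → Fin m → ℕ
idist m i j = ∣ toℕ i - toℕ j ∣ ⊓ (m ∸ ∣ toℕ i - toℕ j ∣)

InM : ℕ → ℕ → Set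
InM Δ x = ∃[ a ] ∃[ b ] (b < a × a < Δ × x ≡ 2 ^ a ∸ 2 ^ b)

module Submission where

-- Let u_i, u_j be distinct, say j = i + D with 0 < D < M.  Because Δ ≤ ⌊log₂ 2M⌋, every
-- offset 2^k (k < Δ) satisfies 1 ≤ 2^k ≤ M, so the neighbour index (a + 2^k - 1) mod M of
-- u_a comes from a number below 2M and reduction mod M subtracts M at most once.
-- Comparing the neighbour indices of u_i and u_j, a common neighbour reached with the
-- offsets 2^k from u_i and 2^l from u_j is of exactly one of two kinds:
--   (A) 2^k = D + 2^l          (no wrap-around), or
--   (B) 2^l = (M - D) + 2^k    (wrap-around).
-- A positive integer has at most one representation 2^p - 2^q, so there is at most one
-- common neighbour of each kind, and one of kind (A) resp. (B) exists iff D ∈ 𝓜_Δ resp.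
-- M - D ∈ 𝓜_Δ.  Hence |N(u_i) ∩ N(u_j)| = 2 iff D, M - D ∈ 𝓜_Δ, a condition symmetric in
-- D and M - D and therefore equivalent to the stated one for id(u_i,u_j) = min(D, M - D).

open import Data.Nat using (ℕ; zero; suc; _+_; _*_; _∸_; _^_; _≤_; _<_; _⊓_; ∣_-_∣; z≤n; s≤s; _<?_; ⌊_/2⌋; ⌈_/2⌉)
open import Data.Nat.Properties
open import Data.Nat.DivMod using (_%_; m%n<n; m<n⇒m%n≡m; m≤n⇒[n∸m]%m≡n%m; [m+n]%n≡m%n)
open import Data.Nat.Logarithm using (⌊log₂_⌋; ⌊log₂⌊n/2⌋⌋≡⌊log₂n⌋∸1)
open import Data.Nat.Tactic.RingSolver using (solve-∀)
open import Data.Fin using (Fin; toℕ; fromℕ<)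
open import Data.Fin.Properties using (toℕ<n; toℕ-fromℕ<; toℕ-injective)
open import Data.List using (List; []; _∷_; length; filter; allFin)
open import Data.List.Properties using (filter-≐)
open import Data.List.Relation.Unary.Any using (here; there)
open import Data.List.Relation.Unary.All using ([]; _∷_)
open import Data.List.Relation.Unary.AllPairs using (_∷_)
open import Data.List.Relation.Unary.Unique.Propositional using (Unique)
open import Data.List.Relation.Unary.Unique.Propositional.Properties using (filter⁺; allFin⁺)
open import Data.List.Membership.Propositional using (_∈_)
open import Data.List.Membership.Propositional.Properties using (∈-filter⁺; ∈-filter⁻; ∈-allFin)
open import Data.Product using (∃; ∃-syntax; _×_; _,_; proj₂; swap)
open import Data.Product.Function.NonDependent.Propositional using (_×-⇔_)
open import Data.Sum using (_⊎_; inj₁; inj₂)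
import Data.Sum as Sum
open import Data.Empty using (⊥; ⊥-elim)
open import Function.Bundles using (_⇔_; mk⇔)
open import Function.Construct.Composition using (_⇔-∘_)
open import Function.Construct.Symmetry using (⇔-sym)
open import Relation.Nullary using (yes; no)
open import Relation.Nullary.Decidable using (_×-dec_)
open import Relation.Unary using (Decidable)
open import Relation.Binary.Definitions using (tri<; tri≈; tri>)
open import Relation.Binary.PropositionalEquality
open import Defs

module _ {A : Set} where

  no-three-in-two : ∀ {x y a b c : A} → a ≢ b → a ≢ c → b ≢ c →
                    a ≡ x ⊎ a ≡ y → b ≡ x ⊎ b ≡ y → c ≡ x ⊎ c ≡ y → ⊥
  no-three-in-two a≢b _   _   (inj₁ refl) (inj₁ refl) _           = a≢b refl
  no-three-in-two a≢b _   _   (inj₂ refl) (inj₂ refl) _           = a≢b refl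
  no-three-in-two _   a≢c _   (inj₁ refl) (inj₂ refl) (inj₁ refl) = a≢c refl
  no-three-in-two _   _   b≢c (inj₁ refl) (inj₂ refl) (inj₂ refl) = b≢c refl
  no-three-in-two _   _   b≢c (inj₂ refl) (inj₁ refl) (inj₁ refl) = b≢c refl
  no-three-in-two _   a≢c _   (inj₂ refl) (inj₁ refl) (inj₂ refl) = a≢c refl

  length≡2 : ∀ {x y} (ys : List A) → Unique ys → x ∈ ys → y ∈ ys → x ≢ y →
             (∀ {z} → z ∈ ys → z ≡ x ⊎ z ≡ y) → length ys ≡ 2
  length≡2 []              _ ()          _           _   _
  length≡2 (a ∷ [])        _ (here refl) (here refl) x≢y _ = ⊥-elim (x≢y refl)
  length≡2 (a ∷ [])        _ _           (there ())  _   _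
  length≡2 (a ∷ [])        _ (there ())  _           _   _
  length≡2 (a ∷ b ∷ [])    _ _           _           _   _ = refl
  length≡2 (a ∷ b ∷ c ∷ _) ((a≢b ∷ a≢c ∷ _) ∷ (b≢c ∷ _) ∷ _) _ _ _ only =
    ⊥-elim (no-three-in-two a≢b a≢c b≢c
              (only (here refl)) (only (there (here refl))) (only (there (there (here refl)))))

  length≡2⇒distinct : ∀ (ys : List A) → Unique ys → length ys ≡ 2 →
                      ∃[ x ] ∃[ y ] (x ≢ y × x ∈ ys × y ∈ ys)
  length≡2⇒distinct []              _                  ()
  length≡2⇒distinct (_ ∷ [])        _                  ()
  length≡2⇒distinct (a ∷ b ∷ [])    ((a≢b ∷ []) ∷ _) _ = a , b , a≢b , here refl , there (here refl)
  length≡2⇒distinct (_ ∷ _ ∷ _ ∷ _) _                  ()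

  module _ {P : A → Set} (P? : Decidable P) {xs : List A} (xs-unique : Unique xs) where

    count≡2 : ∀ {x y} → x ∈ xs → y ∈ xs → x ≢ y → P x → P y →
              (∀ {z} → P z → z ≡ x ⊎ z ≡ y) → length (filter P? xs) ≡ 2
    count≡2 x∈xs y∈xs x≢y Px Py only =
      length≡2 (filter P? xs) (filter⁺ P? xs-unique)
        (∈-filter⁺ P? x∈xs Px) (∈-filter⁺ P? y∈xs Py) x≢y
        (λ z∈ → only (proj₂ (∈-filter⁻ P? {xs = xs} z∈)))

    count≡2⇒distinct : length (filter P? xs) ≡ 2 → ∃[ x ] ∃[ y ] (x ≢ y × P x × P y)
    count≡2⇒distinct eq with length≡2⇒distinct (filter P? xs) (filter⁺ P? xs-unique) eq
    ... | x , y , x≢y , x∈ , y∈ =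
      x , y , x≢y , proj₂ (∈-filter⁻ P? {xs = xs} x∈) , proj₂ (∈-filter⁻ P? {xs = xs} y∈)

gap⇒< : ∀ {c p q} → 0 < c → 2 ^ p ≡ c + 2 ^ q → q < p
gap⇒< {c} {p} {q} c>0 e =
  ≰⇒> λ p≤q → <⇒≱ (m<n+m (2 ^ q) c>0) (subst (_≤ 2 ^ q) e (^-monoʳ-≤ 2 p≤q))

gap-half : ∀ {c p q} → 0 < c → 2 ^ suc p ≡ c + 2 ^ q → 2 ^ p ≤ c
gap-half {c} {p} {q} c>0 e = +-cancelʳ-≤ (2 ^ p) (2 ^ p) c (begin
    2 ^ p + 2 ^ p       ≡⟨ cong (2 ^ p +_) (sym (+-identityʳ (2 ^ p))) ⟩
    2 ^ suc p           ≡⟨ e ⟩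
    c + 2 ^ q           ≤⟨ +-monoʳ-≤ c (^-monoʳ-≤ 2 (<⇒≤pred (gap⇒< {c} {suc p} {q} c>0 e))) ⟩
    c + 2 ^ p           ∎)
  where open ≤-Reasoning

-- Of two representations of c > 0 as a difference of powers, neither has a larger top
-- exponent: 2^(r-1) ≤ c < 2^p.
gap-exponent-≤ : ∀ {c p q r s} → 0 < c → 2 ^ p ≡ c + 2 ^ q → 2 ^ r ≡ c + 2 ^ s → r ≤ p
gap-exponent-≤ {r = zero} _ _ _ = z≤n
gap-exponent-≤ {c} {p} {q} {suc r} {s} c>0 e₁ e₂ =
  ≰⇒> λ p≤r → <⇒≱ lower<upper (^-monoʳ-≤ 2 p≤r)
  where
  open ≤-Reasoning
  lower<upper : 2 ^ r < 2 ^ p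
  lower<upper = begin-strict
    2 ^ r      ≤⟨ gap-half {c} {r} {s} c>0 e₂ ⟩
    c          <⟨ m<m+n c (m^n>0 2 q) ⟩
    c + 2 ^ q  ≡⟨ sym e₁ ⟩
    2 ^ p      ∎

gap-unique : ∀ {c p q r s} → 0 < c → 2 ^ p ≡ c + 2 ^ q → 2 ^ r ≡ c + 2 ^ s → p ≡ r
gap-unique {c} {p} {q} {r} {s} c>0 e₁ e₂ =
  ≤-antisym (gap-exponent-≤ {c} {r} {s} {p} {q} c>0 e₂ e₁) (gap-exponent-≤ {c} {p} {q} {r} {s} c>0 e₁ e₂)

PowerGap : ℕ → ℕ → Set
PowerGap Δ c = ∃[ k ] ∃[ l ] (2 ^ toℕ {Δ} k ≡ c + 2 ^ toℕ {Δ} l)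

InM⇔PowerGap : ∀ {Δ c} → 0 < c → InM Δ c ⇔ PowerGap Δ c
InM⇔PowerGap {Δ} {c} c>0 = mk⇔ to from
  where
  to : InM Δ c → PowerGap Δ c
  to (a , b , b<a , a<Δ , c≡) = fromℕ< a<Δ , fromℕ< b<Δ , top≡
    where
    b<Δ : b < Δ
    b<Δ = <-trans b<a a<Δ
    top≡ : 2 ^ toℕ (fromℕ< a<Δ) ≡ c + 2 ^ toℕ (fromℕ< b<Δ)
    top≡ rewrite toℕ-fromℕ< a<Δ | toℕ-fromℕ< b<Δ | c≡ =
      sym (m∸n+n≡m (^-monoʳ-≤ 2 (<⇒≤ b<a)))

  from : PowerGap Δ c → InM Δ c
  from (k , l , e) = toℕ k , toℕ l , gap⇒< {c} {toℕ k} {toℕ l} c>0 e , toℕ<n k ,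
    sym (trans (cong (_∸ 2 ^ toℕ l) e) (m+n∸n≡m c (2 ^ toℕ l)))

2^k≤n : ∀ k {n} → 0 < n → k ≤ ⌊log₂ n ⌋ → 2 ^ k ≤ n
2^k≤n zero    n>0 _ = n>0
2^k≤n (suc k) {suc zero} _ ()
2^k≤n (suc k) {n@(suc (suc _))} _ k<log = begin
    2 ^ k + (2 ^ k + 0)           ≤⟨ +-mono-≤ ih (+-monoˡ-≤ 0 ih) ⟩
    ⌊ n /2⌋ + (⌊ n /2⌋ + 0)       ≡⟨ cong (⌊ n /2⌋ +_) (+-identityʳ ⌊ n /2⌋) ⟩
    ⌊ n /2⌋ + ⌊ n /2⌋             ≤⟨ +-monoʳ-≤ ⌊ n /2⌋ (⌊n/2⌋≤⌈n/2⌉ n) ⟩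
    ⌊ n /2⌋ + ⌈ n /2⌉             ≡⟨ ⌊n/2⌋+⌈n/2⌉≡n n ⟩
    n                             ∎
  where
  open ≤-Reasoning
  ih : 2 ^ k ≤ ⌊ n /2⌋
  ih = 2^k≤n k (s≤s z≤n)
         (subst (k ≤_) (sym (⌊log₂⌊n/2⌋⌋≡⌊log₂n⌋∸1 n)) (∸-monoˡ-≤ 1 k<log))

offset-bound : ∀ {n M Δ} → n ≡ 2 * M → 2 ≤ n → Δ ≤ ⌊log₂ n ⌋ → (k : Fin Δ) → 2 ^ toℕ k ≤ M
offset-bound {n} n≡2M 2≤n Δ≤log k = *-cancelˡ-≤ 2 (subst (2 ^ suc (toℕ k) ≤_) n≡2M
  (2^k≤n (suc (toℕ k)) (≤-trans (s≤s z≤n) 2≤n) (≤-trans (toℕ<n k) Δ≤log)))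

module NeighbourIndex (M-1 : ℕ) where

  M : ℕ
  M = suc M-1

  nbr : ℕ → ℕ → ℕ
  nbr a s = (a + s ∸ 1) % M

  nbrVertex : ℕ → ℕ → Fin M
  nbrVertex a s = fromℕ< (m%n<n (a + s ∸ 1) M)

  toℕ-nbrVertex : ∀ a s → toℕ (nbrVertex a s) ≡ nbr a s
  toℕ-nbrVertex a s = toℕ-fromℕ< (m%n<n (a + s ∸ 1) M)

  Offset : ℕ → Set
  Offset s = 0 < s × s ≤ M

  below-2M : ∀ x → x < M + M → x ≡ x % M ⊎ x ≡ x % M + M
  below-2M x x<2M with x <? M
  ... | yes x<M = inj₁ (sym (m<n⇒m%n≡m x<M))
  ... | no  x≮M = inj₂ (begin
      x             ≡⟨ sym (m∸n+n≡m M≤x) ⟩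
      x ∸ M + M     ≡⟨ cong (_+ M) (sym x%M≡x∸M) ⟩
      x % M + M     ∎)
    where
    open ≡-Reasoning
    M≤x : M ≤ x
    M≤x = ≮⇒≥ x≮M
    x∸M<M : x ∸ M < M
    x∸M<M = subst (x ∸ M <_) (m+n∸n≡m M M) (∸-monoˡ-< x<2M M≤x)
    x%M≡x∸M : x % M ≡ x ∸ M
    x%M≡x∸M = trans (sym (m≤n⇒[n∸m]%m≡n%m M≤x)) (m<n⇒m%n≡m x∸M<M)

  same-residue : ∀ x y → x < M + M → y < M + M → x % M ≡ y % M →
                 x ≡ y ⊎ x ≡ y + M ⊎ x + M ≡ y
  same-residue x y x<2M y<2M e with below-2M x x<2M | below-2M y y<2M
  ... | inj₁ x≡ | inj₁ y≡ = inj₁ (trans x≡ (trans e (sym y≡)))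
  ... | inj₁ x≡ | inj₂ y≡ = inj₂ (inj₂ (trans (cong (_+ M) (trans x≡ e)) (sym y≡)))
  ... | inj₂ x≡ | inj₁ y≡ = inj₂ (inj₁ (trans x≡ (cong (_+ M) (trans e (sym y≡)))))
  ... | inj₂ x≡ | inj₂ y≡ = inj₁ (trans x≡ (trans (cong (_+ M) e) (sym y≡)))

  same-pred-residue : ∀ x y → 0 < x → 0 < y → x ≤ M + M → y ≤ M + M →
                      (x ∸ 1) % M ≡ (y ∸ 1) % M → x ≡ y ⊎ x ≡ y + M ⊎ x + M ≡ y
  same-pred-residue (suc x) (suc y) _ _ x<2M y<2M e =
    Sum.map (cong suc) (Sum.map (cong suc) (cong suc)) (same-residue x y x<2M y<2M e)

  nbr-cases : ∀ {a s b t} → a < M → Offset s → b < M → Offset t → nbr a s ≡ nbr b t →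
              a + s ≡ b + t ⊎ a + s ≡ b + t + M ⊎ a + s + M ≡ b + t
  nbr-cases {a} {s} {b} {t} a<M (s>0 , s≤M) b<M (t>0 , t≤M) =
    same-pred-residue (a + s) (b + t)
      (≤-trans s>0 (m≤n+m s a)) (≤-trans t>0 (m≤n+m t b))
      (<⇒≤ (+-mono-<-≤ a<M s≤M)) (<⇒≤ (+-mono-<-≤ b<M t≤M))

  no-overshoot : ∀ {a b s t} → a ≤ b → s ≤ M → 0 < t → a + s < b + t + M
  no-overshoot {a} {b} {s} {t} a≤b s≤M t>0 = begin-strict
    a + s         ≤⟨ +-mono-≤ a≤b s≤M ⟩
    b + M         <⟨ +-monoʳ-< b (m<n+m M t>0) ⟩
    b + (t + M)   ≡⟨ sym (+-assoc b t M) ⟩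
    b + t + M     ∎
    where open ≤-Reasoning

  nbr-injective : ∀ {a s t} → a < M → Offset s → Offset t → nbr a s ≡ nbr a t → s ≡ t
  nbr-injective {a} {s} {t} a<M os@(s>0 , s≤M) ot@(t>0 , t≤M) e with nbr-cases a<M os a<M ot e
  ... | inj₁ q        = +-cancelˡ-≡ a s t q
  ... | inj₂ (inj₁ q) = ⊥-elim (<-irrefl q (no-overshoot ≤-refl s≤M t>0))
  ... | inj₂ (inj₂ q) = ⊥-elim (<-irrefl (sym q) (no-overshoot ≤-refl t≤M s>0))

  wrap-offset : ∀ {D s t} → D ≤ M → s + M ≡ D + t → t ≡ (M ∸ D) + s
  wrap-offset {D} {s} {t} D≤M e = +-cancelˡ-≡ D t (M ∸ D + s) (begin
    D + t               ≡⟨ sym e ⟩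
    s + M               ≡⟨ +-comm s M ⟩
    M + s               ≡⟨ cong (_+ s) (sym (m+[n∸m]≡n D≤M)) ⟩
    D + (M ∸ D) + s     ≡⟨ +-assoc D (M ∸ D) s ⟩
    D + (M ∸ D + s)     ∎)
    where open ≡-Reasoning

  summand≤ : ∀ {a D b} → a + D ≡ b → a ≤ b
  summand≤ {a} {D} e = subst (a ≤_) e (m≤m+n a D)

  nbr-classify : ∀ {a b D s t} → a + D ≡ b → b < M → Offset s → Offset t →
                 nbr a s ≡ nbr b t → s ≡ D + t ⊎ t ≡ (M ∸ D) + s
  nbr-classify {a} {b} {D} {s} {t} a+D≡b b<M os@(_ , s≤M) ot@(t>0 , _) e
    with nbr-cases (≤-<-trans (summand≤ a+D≡b) b<M) os b<M ot e
  ... | inj₁ q        = inj₁ (+-cancelˡ-≡ a s (D + t) (begin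
      a + s         ≡⟨ q ⟩
      b + t         ≡⟨ cong (_+ t) (sym a+D≡b) ⟩
      a + D + t     ≡⟨ +-assoc a D t ⟩
      a + (D + t)   ∎))
    where open ≡-Reasoning
  ... | inj₂ (inj₁ q) = ⊥-elim (<-irrefl q (no-overshoot (summand≤ a+D≡b) s≤M t>0))
  ... | inj₂ (inj₂ q) = inj₂ (wrap-offset D≤M (+-cancelˡ-≡ a (s + M) (D + t) (begin
      a + (s + M)   ≡⟨ sym (+-assoc a s M) ⟩
      a + s + M     ≡⟨ q ⟩
      b + t         ≡⟨ cong (_+ t) (sym a+D≡b) ⟩
      a + D + t     ≡⟨ +-assoc a D t ⟩
      a + (D + t)   ∎)))
    where
    open ≡-Reasoning
    D≤M : D ≤ M
    D≤M = ≤-trans (summand≤ (trans (+-comm D a) a+D≡b)) (<⇒≤ b<M)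

  nbr-same-position : ∀ {a s b t} → a + s ≡ b + t → nbr a s ≡ nbr b t
  nbr-same-position e = cong (λ x → (x ∸ 1) % M) e

  nbr-wrap : ∀ {a s b t} → 0 < a + s → a + s + M ≡ b + t → nbr a s ≡ nbr b t
  nbr-wrap {a} {s} {b} {t} pos e = begin
    (a + s ∸ 1) % M         ≡⟨ sym ([m+n]%n≡m%n (a + s ∸ 1) M) ⟩
    (a + s ∸ 1 + M) % M     ≡⟨ cong (_% M) (sym (+-∸-comm M pos)) ⟩
    (a + s + M ∸ 1) % M     ≡⟨ cong (λ x → (x ∸ 1) % M) e ⟩
    (b + t ∸ 1) % M         ∎
    where open ≡-Reasoning

module CommonNeighbours (M-1 Δ : ℕ) (offsets-small : ∀ (k : Fin Δ) → 2 ^ toℕ k ≤ suc M-1)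
                        (i j : Fin (suc M-1)) (D : ℕ) (i+D≡j : toℕ i + D ≡ toℕ j) (D>0 : 0 < D)
                        where

  open NeighbourIndex M-1

  a b : ℕ
  a = toℕ i
  b = toℕ j

  D<M : D < M
  D<M = ≤-<-trans (summand≤ (trans (+-comm D a) i+D≡j)) (toℕ<n j)

  M∸D>0 : 0 < M ∸ D
  M∸D>0 = m<n⇒0<n∸m D<M

  pow : Fin Δ → ℕ
  pow k = 2 ^ toℕ k

  offset : (k : Fin Δ) → Offset (pow k)
  offset k = m^n>0 2 (toℕ k) , offsets-small k

  Via : Fin M → Fin Δ → Fin Δ → Set
  Via v k l = toℕ v ≡ nbr a (pow k) × toℕ v ≡ nbr b (pow l)

  KindA : Fin M → Set
  KindA v = ∃[ k ] ∃[ l ] (Via v k l × pow k ≡ D + pow l)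

  KindB : Fin M → Set
  KindB v = ∃[ k ] ∃[ l ] (Via v k l × pow l ≡ (M ∸ D) + pow k)

  Common : Fin M → Set
  Common v = Adj M Δ i v × Adj M Δ j v

  kind⇒common : ∀ {v} → KindA v ⊎ KindB v → Common v
  kind⇒common (inj₁ (k , l , (at-i , at-j) , _)) = (k , at-i) , (l , at-j)
  kind⇒common (inj₂ (k , l , (at-i , at-j) , _)) = (k , at-i) , (l , at-j)

  common⇒kind : ∀ {v} → Common v → KindA v ⊎ KindB v
  common⇒kind ((k , at-i) , (l , at-j)) =
    Sum.map (λ e → k , l , (at-i , at-j) , e) (λ e → k , l , (at-i , at-j) , e)
      (nbr-classify i+D≡j (toℕ<n j) (offset k) (offset l) (trans (sym at-i) at-j))

  -- There is at most one common neighbour of kind (A): its offset from u_i is determined by D.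
  kindA-unique : ∀ {v w} → KindA v → KindA w → v ≡ w
  kindA-unique {v} {w} (k , l , (v-at , _) , e) (k' , l' , (w-at , _) , e') = toℕ-injective (begin
    toℕ v               ≡⟨ v-at ⟩
    nbr a (pow k)       ≡⟨ cong (λ x → nbr a (2 ^ x)) (gap-unique {D} {toℕ k} {toℕ l} {toℕ k'} {toℕ l'} D>0 e e') ⟩
    nbr a (pow k')      ≡⟨ sym w-at ⟩
    toℕ w               ∎)
    where open ≡-Reasoning

  -- There is at most one common neighbour of kind (B): its offset from u_j is determined by M - D.
  kindB-unique : ∀ {v w} → KindB v → KindB w → v ≡ w
  kindB-unique {v} {w} (k , l , (_ , v-at) , e) (k' , l' , (_ , w-at) , e') = toℕ-injective (begin
    toℕ v               ≡⟨ v-at ⟩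
    nbr b (pow l)       ≡⟨ cong (λ x → nbr b (2 ^ x)) (gap-unique {M ∸ D} {toℕ l} {toℕ k} {toℕ l'} {toℕ k'} M∸D>0 e e') ⟩
    nbr b (pow l')      ≡⟨ sym w-at ⟩
    toℕ w               ∎)
    where open ≡-Reasoning

  -- No vertex is of both kinds: the offsets would satisfy 2^l < 2^k and 2^k < 2^l.
  kinds-disjoint : ∀ {v} → KindA v → KindB v → ⊥
  kinds-disjoint (k , l , (at-i , at-j) , e) (k' , l' , (at-i' , at-j') , e') =
    <-irrefl refl (begin-strict
      pow l     <⟨ subst (pow l <_) (sym e) (m<n+m (pow l) D>0) ⟩
      pow k     ≡⟨ nbr-injective (toℕ<n i) (offset k) (offset k') (trans (sym at-i) at-i') ⟩
      pow k'    <⟨ subst (pow k' <_) (sym e') (m<n+m (pow k') M∸D>0) ⟩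
      pow l'    ≡⟨ nbr-injective (toℕ<n j) (offset l') (offset l) (trans (sym at-j') at-j) ⟩
      pow l     ∎)
    where open ≤-Reasoning

  gap⇒kindA : PowerGap Δ D → ∃ KindA
  gap⇒kindA (k , l , e) = nbrVertex a (pow k) , k , l , (at-i , trans at-i same) , e
    where
    at-i : toℕ (nbrVertex a (pow k)) ≡ nbr a (pow k)
    at-i = toℕ-nbrVertex a (pow k)
    same : nbr a (pow k) ≡ nbr b (pow l)
    same = nbr-same-position {a} {pow k} {b} {pow l} (begin
      a + pow k           ≡⟨ cong (a +_) e ⟩
      a + (D + pow l)     ≡⟨ sym (+-assoc a D (pow l)) ⟩
      a + D + pow l       ≡⟨ cong (_+ pow l) i+D≡j ⟩
      b + pow l           ∎)
      where open ≡-Reasoning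

  gap⇒kindB : PowerGap Δ (M ∸ D) → ∃ KindB
  gap⇒kindB (l , k , e) = nbrVertex a (pow k) , k , l , (at-i , trans at-i wrap) , e
    where
    at-i : toℕ (nbrVertex a (pow k)) ≡ nbr a (pow k)
    at-i = toℕ-nbrVertex a (pow k)
    regroup : ∀ a s D X → a + s + (D + X) ≡ a + D + (X + s)
    regroup = solve-∀
    wrap : nbr a (pow k) ≡ nbr b (pow l)
    wrap = nbr-wrap {a} {pow k} {b} {pow l} (≤-trans (m^n>0 2 (toℕ k)) (m≤n+m (pow k) a)) (begin
      a + pow k + M                 ≡⟨ cong (a + pow k +_) (sym (m+[n∸m]≡n (<⇒≤ D<M))) ⟩
      a + pow k + (D + (M ∸ D))     ≡⟨ regroup a (pow k) D (M ∸ D) ⟩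
      a + D + ((M ∸ D) + pow k)     ≡⟨ cong₂ _+_ i+D≡j (sym e) ⟩
      b + pow l                     ∎)
      where open ≡-Reasoning

  commonNbrs≡2⇔gaps : commonNbrs M Δ i j ≡ 2 ⇔ (PowerGap Δ D × PowerGap Δ (M ∸ D))
  commonNbrs≡2⇔gaps = mk⇔ to from
    where
    common? = λ v → adj? M Δ i v ×-dec adj? M Δ j v

    to : commonNbrs M Δ i j ≡ 2 → PowerGap Δ D × PowerGap Δ (M ∸ D)
    to eq with count≡2⇒distinct common? (allFin⁺ M) eq
    ... | v , w , v≢w , v-common , w-common with common⇒kind v-common | common⇒kind w-common
    ... | inj₁ A | inj₁ A' = ⊥-elim (v≢w (kindA-unique A A'))
    ... | inj₂ B | inj₂ B' = ⊥-elim (v≢w (kindB-unique B B'))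
    ... | inj₁ (k , l , _ , e) | inj₂ (k' , l' , _ , e') = (k , l , e) , (l' , k' , e')
    ... | inj₂ (k' , l' , _ , e') | inj₁ (k , l , _ , e) = (k , l , e) , (l' , k' , e')

    from : PowerGap Δ D × PowerGap Δ (M ∸ D) → commonNbrs M Δ i j ≡ 2
    from (gap-D , gap-M∸D) with gap⇒kindA gap-D | gap⇒kindB gap-M∸D
    ... | v , A | w , B =
      count≡2 common? (allFin⁺ M) (∈-allFin v) (∈-allFin w) v≢w
        (kind⇒common (inj₁ A)) (kind⇒common (inj₂ B)) only-v-w
      where
      v≢w : v ≢ w
      v≢w refl = kinds-disjoint A B
      only-v-w : ∀ {z} → Common z → z ≡ v ⊎ z ≡ w
      only-v-w z-common =
        Sum.map (λ A' → kindA-unique A' A) (λ B' → kindB-unique B' B) (common⇒kind z-common)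

  commonNbrs≡2⇔InM : commonNbrs M Δ i j ≡ 2 ⇔ (InM Δ D × InM Δ (M ∸ D))
  commonNbrs≡2⇔InM =
    ⇔-sym (InM⇔PowerGap D>0 ×-⇔ InM⇔PowerGap M∸D>0) ⇔-∘ commonNbrs≡2⇔gaps

symmetric-⊓ : ∀ (P : ℕ → Set) {D M} → D ≤ M →
              (P D × P (M ∸ D)) ⇔ (P (D ⊓ (M ∸ D)) × P (M ∸ (D ⊓ (M ∸ D))))
symmetric-⊓ P {D} {M} D≤M with ≤-total D (M ∸ D)
... | inj₁ D≤M∸D rewrite m≤n⇒m⊓n≡m D≤M∸D = mk⇔ (λ x → x) (λ x → x)
... | inj₂ M∸D≤D rewrite m≥n⇒m⊓n≡n M∸D≤D | m∸[m∸n]≡n D≤M = mk⇔ swap swap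

commonNbrs-comm : ∀ m Δ (i j : Fin m) → commonNbrs m Δ i j ≡ commonNbrs m Δ j i
commonNbrs-comm m Δ i j = cong length
  (filter-≐ (λ v → adj? m Δ i v ×-dec adj? m Δ j v) (λ v → adj? m Δ j v ×-dec adj? m Δ i v)
     (swap , swap) (allFin m))

idist-comm : ∀ m (i j : Fin m) → idist m i j ≡ idist m j i
idist-comm m i j = cong (λ d → d ⊓ (m ∸ d)) (∣-∣-comm (toℕ i) (toℕ j))

ordered-pair : ∀ M-1 Δ → (∀ (k : Fin Δ) → 2 ^ toℕ k ≤ suc M-1) →
               (i j : Fin (suc M-1)) → toℕ i < toℕ j →
               commonNbrs (suc M-1) Δ i j ≡ 2 ⇔
                 (InM Δ (idist (suc M-1) i j) × InM Δ (suc M-1 ∸ idist (suc M-1) i j))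
ordered-pair M-1 Δ offsets-small i j i<j rewrite m≤n⇒∣m-n∣≡n∸m (<⇒≤ i<j) =
  symmetric-⊓ (InM Δ) (<⇒≤ D<M) ⇔-∘ commonNbrs≡2⇔InM
  where
  open CommonNeighbours M-1 Δ offsets-small i j (toℕ j ∸ toℕ i)
         (m+[n∸m]≡n (<⇒≤ i<j)) (m<n⇒0<n∸m i<j)

distinct-pair : ∀ M-1 Δ → (∀ (k : Fin Δ) → 2 ^ toℕ k ≤ suc M-1) →
                (i j : Fin (suc M-1)) → i ≢ j →
                commonNbrs (suc M-1) Δ i j ≡ 2 ⇔
                  (InM Δ (idist (suc M-1) i j) × InM Δ (suc M-1 ∸ idist (suc M-1) i j))
distinct-pair M-1 Δ offsets-small i j i≢j with <-cmp (toℕ i) (toℕ j)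
... | tri< i<j _ _ = ordered-pair M-1 Δ offsets-small i j i<j
... | tri≈ _ i≡j _ = ⊥-elim (i≢j (toℕ-injective i≡j))
... | tri> _ _ j<i rewrite commonNbrs-comm (suc M-1) Δ i j | idist-comm (suc M-1) i j =
  ordered-pair M-1 Δ offsets-small j i j<i

lemma2p4 : (n m Δ : ℕ) → n ≡ 2 * m → 2 ≤ n → 1 ≤ Δ → Δ ≤ ⌊log₂ n ⌋ →
    (i j : Fin m) → i ≢ j →
    (commonNbrs m Δ i j ≡ 2 ⇔ (InM Δ (idist m i j) × InM Δ (m ∸ idist m i j)))
lemma2p4 n zero      Δ _     _   _ _     () _
lemma2p4 n (suc M-1) Δ n≡2M 2≤n _ Δ≤log i j i≢j =
  distinct-pair M-1 Δ (offset-bound n≡2M 2≤n Δ≤log) i j i≢j
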